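{- Let $n,k>0$ and $m\ge0$ be integers. The number of labeled $m$-barred Callan sequences of size $n\times k$ equals the symmetrized poly-Bernoulli number $\mathcal{B}_n^{(-k)}(m)$. Moreover $\mathcal{B}_n^{(-k)}(m)=\mathcal{B}_k^{(-n)}(m)$.
   Context: For $k\in\mathbb{Z}$ the poly-Bernoulli polynomials $B_n^{(k)}(x)$ are defined by $\sum_{n\ge 0}B_n^{(k)}(x)\frac{t^n}{n!}=e^{ -xt}\frac{\mathrm{Li}_k(1-e^{ -t})}{1-e^{ -t}}$, where $\mathrm{Li}_k(z)=\sum_{j\ge1}z^j/j^k$. Let $\genfrac{[}{]}{0pt}{}{m}{j}$ denote the unsigned Stirling numbers of the first kind. For nonnegative integers $n,k,m$ the symmetrized poly-Bernoulli number is $\mathcal{B}_n^{(-k)}(m):=\sum_{j=0}^{m}\genfrac{[}{]}{0pt}{}{m}{j}B_n^{(-k-j)}(m)$. Callan sequences: for integers $n,k\ge 0$ let $N=\{1,\dots,n\}\cup\{*\}$ (red elements) and $K=\{1,\dots,k\}\cup\{*'\}$ (blue elements). A Callan sequence of size $n\times k$ consists of an integer $r\ge 0$, a set partition of $N$ into $r+1$ nonempty blocks $R_1,\dots,R_r,R^*$ with $*\in R^*$, and a set partition of $K$ into $r+1$ nonempty blocks $B_1,\dots,B_r,B^*$ with $*'\in B^*$, arranged as the ordered list of $r$ ordinary pairs $(B_1;R_1)\cdots(B_r;R_r)$ together with the extra pair $(B^*;R^*)$; the order of the ordinary pairs matters. An $m$-barred Callan sequence is a Callan sequence with $m$ indistinguishable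 bars placed in the $r+1$ gaps before, between and after the ordinary pairs (several bars per gap allowed). A labeled $m$-barred Callan sequence is the same object but with $m$ distinguishable (labeled) bars, i.e. a Callan sequence together with a linear arrangement interleaving the ordered list of $r$ ordinary pairs with $m$ distinct bars (the relative order of bars within one gap matters). -}

module Defs where

open import Data.Bool using (Bool; true; false; T; _∧_)
open import Data.Nat as ℕ using (ℕ; zero; suc; _∸_; _≡ᵇ_)
open import Data.Nat.Combinatorics using (_C_)
open import Data.Integer as ℤ using (ℤ; +_; -_; _+_; _*_; _^_)
open import Data.Fin as Fin using (Fin)
open import Data.Maybe using (Maybe; just; nothing)
open import Data.Vec using (Vec; toList; []; _∷_)
open import Data.List using (List; allFin)
open import Data.Bool.ListAction using (all; any)
open import Data.Product using (Σ; Σ-syntax; _×_)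
open import Relation.Nullary using (does)

sumUpTo : ℕ → (ℕ → ℤ) → ℤ
sumUpTo zero    f = f 0
sumUpTo (suc n) f = sumUpTo n f + f (suc n)

-- Exponential generating functions, represented by their sequence of
-- coefficients  a n = n! [t^n] A(t).  Product of EGFs = binomial convolution.

EGF : Set
EGF = ℕ → ℤ

_⊛_ : EGF → EGF → EGF
(f ⊛ g) n = sumUpTo n (λ i → + (n C i) * f i * g (n ∸ i))

oneEGF : EGF
oneEGF zero    = + 1
oneEGF (suc _) = + 0

powEGF : EGF → ℕ → EGF
powEGF f zero    = oneEGF
powEGF f (suc j) = f ⊛ powEGF f j

expNeg : ℤ → EGF
expNeg x n = (- x) ^ n

oneMinusExpNeg : EGF
oneMinusExpNeg zero    = + 0
oneMinusExpNeg (suc n) = - ((- (+ 1)) ^ suc n)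

-- Li_{-k}(1 - e^{-t}) / (1 - e^{-t}) = Σ_{j≥1} j^k (1 - e^{-t})^{j-1}.
-- Since (1-e^{-t})^{j-1} = O(t^{j-1}), the coefficient of t^n only
-- receives contributions from j ≤ n+1, so the sum is truncated there.
liQuot : ℕ → EGF
liQuot k n = sumUpTo n (λ i → (+ suc i) ^ k * powEGF oneMinusExpNeg i n)

-- Poly-Bernoulli polynomial with negative upper index:
--   polyBernoulliNeg n k x = B_n^{(-k)}(x),
-- defined by Σ_n B_n^{(-k)}(x) t^n/n! = e^{-xt} Li_{-k}(1-e^{-t})/(1-e^{-t}).
polyBernoulliNeg : ℕ → ℕ → ℤ → ℤ
polyBernoulliNeg n k x = (expNeg x ⊛ liQuot k) n

stirling1 : ℕ → ℕ → ℕ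
stirling1 zero    zero    = 1
stirling1 zero    (suc j) = 0
stirling1 (suc m) zero    = 0
stirling1 (suc m) (suc j) = m ℕ.* stirling1 m (suc j) ℕ.+ stirling1 m j

symPolyBernoulli : ℕ → ℕ → ℕ → ℤ
symPolyBernoulli n k m =
  sumUpTo m (λ j → + stirling1 m j * polyBernoulliNeg n (k ℕ.+ j) (+ m))

-- Encoding: a Callan sequence with r ordinary pairs is given by
--   red  : Vec (Fin (suc r)) n  -- red element i (of 1..n) lies in block
--                                  R^* if red[i] = 0, in R_j if red[i] = j
--   blue : Vec (Fin (suc r)) k  -- likewise for blue elements
-- The element * is always in R^* and *' always in B^*.  Blocks R_1..R_r
-- and B_1..B_r must be nonempty (R^*, B^* are nonempty as they contain
-- * resp. *'), i.e. every j ∈ {1..r} is hit.  Pair number j is (B_j;R_j).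

hits : ∀ {r l} → Vec (Fin (suc r)) l → Fin r → Bool
hits v j = any (λ x → does (x Fin.≟ Fin.suc j)) (toList v)

ordinaryBlocksNonempty : ∀ {r l} → Vec (Fin (suc r)) l → Bool
ordinaryBlocksNonempty {r} v = all (hits v) (allFin r)

-- A linear arrangement interleaving the r ordinary pairs (in their order)
-- with m labeled bars: a word of length r + m in which `nothing` marks
-- the next ordinary pair and `just b` marks bar b; every bar occurs
-- exactly once (hence exactly r letters are `nothing`).
occurrences : ∀ {m l} → Fin m → Vec (Maybe (Fin m)) l → ℕ
occurrences b []             = 0
occurrences b (nothing ∷ w)  = occurrences b w
occurrences b (just c ∷ w)   with does (c Fin.≟ b)
... | true  = suc (occurrences b w)
... | false = occurrences b w

isArrangement : ∀ {m l} → Vec (Maybe (Fin m)) l → Bool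
isArrangement {m} w = all (λ b → occurrences b w ≡ᵇ 1) (allFin m)

record LabeledBarredCallan (n k m : ℕ) : Set where
  constructor callan
  field
    r           : ℕ
    red         : Vec (Fin (suc r)) n
    blue        : Vec (Fin (suc r)) k
    arrangement : Vec (Maybe (Fin m)) (r ℕ.+ m)
    valid       : T (ordinaryBlocksNonempty red ∧ ordinaryBlocksNonempty blue
                      ∧ isArrangement arrangement)

module Submission where

-- Both sides are compared with the explicit, visibly symmetric count
--   callanCount n k m = Σ_r markedWords 1 r n · markedWords 1 r k · (r+1)^{(m)},
-- where markedWords 1 r n counts the distributions of n labelled elements into the
-- block of * and r ordinary blocks, the ordinary ones nonempty; the rising factorial
-- (r+1)^{(m)} counts the interleavings of r ordinary pairs with m labelled bars.
--
-- Algebra: finite sums and binomials, then the EGF calculus (product, derivative,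
-- Leibniz rule) giving recurrences for  Y_i = e^{-mt}(1 - e^{-t})^i.  With them
--   𝓑_n^{(-k)}(m) = Σ_i (i+1)^k (i+1)^{(m)} [t^n/n!] Y_i,   (i+1)^k = Σ_r C(i,r) markedWords 1 r k,
--   C(i,r) (i+1)^{(m)} = (r+1)^{(m)} C(i+m, r+m),   markedWords 1 r n = Σ_i C(i+m, r+m) [t^n/n!] Y_i,
-- which combine to  𝓑_n^{(-k)}(m) = callanCount n k m.

open import Defs
open import Data.Bool using (Bool; true; false; T; _∧_; _∨_; not; if_then_else_)
open import Data.Bool.ListAction using (all)
import Data.Bool.Properties as BoolP
open import Data.Nat as ℕ using (ℕ; zero; suc; pred; _∸_; _≡ᵇ_; z≤n; s≤s; NonZero)
import Data.Nat.Properties as ℕP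
import Data.Nat.Tactic.RingSolver as ℕSolver
open import Data.Nat.Combinatorics using (_C_)
import Data.Nat.Combinatorics as Comb
open import Data.Integer using (ℤ; +_; -_; _+_; _*_; _^_; _-_)
import Data.Integer.Properties as ℤP
open import Data.Integer.Tactic.RingSolver using (solve-∀)
open import Data.Fin as Fin using (Fin; zero; suc)
import Data.Fin.Properties as FinP
open import Data.Maybe using (Maybe; just; nothing)
open import Data.Vec using (Vec; []; _∷_)
open import Data.List using (tabulate; allFin)
open import Data.Sum using (_⊎_; inj₁; inj₂)
open import Data.Sum.Function.Propositional using (_⊎-↔_)
open import Data.Product using (Σ; _×_; _,_; proj₁; proj₂)
open import Data.Product.Function.NonDependent.Propositional using (_×-↔_)
import Data.Product.Function.Dependent.Propositional as ΣP
open import Data.Empty using (⊥; ⊥-elim)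
open import Data.Unit using (tt)
open import Function.Bundles using (_↔_; mk↔ₛ′; Equivalence)
open import Function.Related.Propositional using (bijection)
open import Function.Properties.Inverse using (↔-trans; ↔-sym; ↔-refl)
open import Relation.Nullary using (does; yes; no)
open import Relation.Binary.PropositionalEquality
  using (_≡_; refl; sym; trans; cong; cong₂; subst; module ≡-Reasoning)

sum-cong : ∀ n {f g : ℕ → ℤ} → (∀ i → f i ≡ g i) → sumUpTo n f ≡ sumUpTo n g
sum-cong zero    e = e 0
sum-cong (suc n) e = cong₂ _+_ (sum-cong n e) (e (suc n))

sum-cong≤ : ∀ n {f g : ℕ → ℤ} → (∀ i → i ℕ.≤ n → f i ≡ g i) → sumUpTo n f ≡ sumUpTo n g
sum-cong≤ zero    e = e 0 z≤n
sum-cong≤ (suc n) e =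
  cong₂ _+_ (sum-cong≤ n (λ i p → e i (ℕP.m≤n⇒m≤1+n p))) (e (suc n) ℕP.≤-refl)

sum-+ : ∀ n (f g : ℕ → ℤ) → sumUpTo n (λ i → f i + g i) ≡ sumUpTo n f + sumUpTo n g
sum-+ zero    f g = refl
sum-+ (suc n) f g rewrite sum-+ n f g = interchange (sumUpTo n f) (sumUpTo n g) (f (suc n)) (g (suc n))
  where interchange : ∀ a b c d → a + b + (c + d) ≡ a + c + (b + d)
        interchange = solve-∀

sum-scale : ∀ n c (f : ℕ → ℤ) → sumUpTo n (λ i → c * f i) ≡ c * sumUpTo n f
sum-scale zero    c f = refl
sum-scale (suc n) c f rewrite sum-scale n c f = sym (ℤP.*-distribˡ-+ c (sumUpTo n f) (f (suc n)))

sum-lin : ∀ n a b (f g : ℕ → ℤ) →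
  sumUpTo n (λ i → a * f i + b * g i) ≡ a * sumUpTo n f + b * sumUpTo n g
sum-lin n a b f g = trans (sum-+ n _ _) (cong₂ _+_ (sum-scale n a f) (sum-scale n b g))

sum-zero : ∀ n (f : ℕ → ℤ) → (∀ i → f i ≡ + 0) → sumUpTo n f ≡ + 0
sum-zero zero    f e = e 0
sum-zero (suc n) f e rewrite sum-zero n f e | e (suc n) = refl

sum-first : ∀ n (f : ℕ → ℤ) → sumUpTo (suc n) f ≡ f 0 + sumUpTo n (λ i → f (suc i))
sum-first zero    f = refl
sum-first (suc n) f rewrite sum-first n f = ℤP.+-assoc (f 0) _ _

sum-only-first : ∀ n (f : ℕ → ℤ) → (∀ i → f (suc i) ≡ + 0) → sumUpTo n f ≡ f 0
sum-only-first zero    f e = refl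
sum-only-first (suc n) f e rewrite sum-only-first n f e | e n = ℤP.+-identityʳ (f 0)

sum-pad : ∀ p n (f : ℕ → ℤ) → p ℕ.≤ n → (∀ i → p ℕ.< i → f i ≡ + 0) → sumUpTo n f ≡ sumUpTo p f
sum-pad p n f p≤n e =
  trans (cong (λ q → sumUpTo q f) (sym (ℕP.m∸n+n≡m p≤n))) (pad (n ∸ p))
  where
    pad : ∀ d → sumUpTo (d ℕ.+ p) f ≡ sumUpTo p f
    pad zero    = refl
    pad (suc d) rewrite pad d | e (suc (d ℕ.+ p)) (s≤s (ℕP.m≤n+m p d)) = ℤP.+-identityʳ _

sum-swap : ∀ a b (f : ℕ → ℕ → ℤ) →
  sumUpTo a (λ i → sumUpTo b (λ j → f i j)) ≡ sumUpTo b (λ j → sumUpTo a (λ i → f i j))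
sum-swap zero    b f = refl
sum-swap (suc a) b f rewrite sum-swap a b f =
  sym (sum-+ b (λ j → sumUpTo a (λ i → f i j)) (λ j → f (suc a) j))

-- Binomial coefficients defined by Pascal's rule; they agree with the
-- library's  n C k  but compute by recursion, which the proofs need.

bin : ℕ → ℕ → ℕ
bin zero    zero    = 1
bin zero    (suc k) = 0
bin (suc n) zero    = 1
bin (suc n) (suc k) = bin n k ℕ.+ bin n (suc k)

bin≡C : ∀ n k → bin n k ≡ n C k
bin≡C zero    zero    = refl
bin≡C zero    (suc k) = refl
bin≡C (suc n) zero    = refl
bin≡C (suc n) (suc k) rewrite bin≡C n k | bin≡C n (suc k) = Comb.nCk+nC[k+1]≡[n+1]C[k+1] n k

bin-vanish : ∀ n k → n ℕ.< k → bin n k ≡ 0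
bin-vanish zero    (suc k) _ = refl
bin-vanish (suc n) (suc k) (s≤s p)
  rewrite bin-vanish n k p | bin-vanish n (suc k) (ℕP.m≤n⇒m≤1+n p) = refl

bin-n0 : ∀ n → bin n 0 ≡ 1
bin-n0 zero    = refl
bin-n0 (suc n) = refl

bin-n1 : ∀ n → bin n 1 ≡ n
bin-n1 zero    = refl
bin-n1 (suc n) rewrite bin-n1 n | bin-n0 n = refl

bin-nn : ∀ n → bin n n ≡ 1
bin-nn zero    = refl
bin-nn (suc n) rewrite bin-nn n | bin-vanish n (suc n) ℕP.≤-refl = refl

bin-absorb : ∀ n k → suc k ℕ.* bin (suc n) (suc k) ≡ suc n ℕ.* bin n k
bin-absorb zero    zero    = refl
bin-absorb zero    (suc k) = ℕP.*-zeroʳ (suc (suc k))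
bin-absorb (suc n) zero rewrite bin-n1 n | bin-n0 n = ℕP.*-comm 1 (suc (suc n))
bin-absorb (suc n) (suc k) = begin
    suc (suc k) ℕ.* (bin (suc n) (suc k) ℕ.+ bin (suc n) (suc (suc k)))
  ≡⟨ ℕP.*-distribˡ-+ (suc (suc k)) (bin (suc n) (suc k)) _ ⟩
    suc (suc k) ℕ.* bin (suc n) (suc k) ℕ.+ suc (suc k) ℕ.* bin (suc n) (suc (suc k))
  ≡⟨ cong₂ (λ x y → bin (suc n) (suc k) ℕ.+ x ℕ.+ y) (bin-absorb n k) (bin-absorb n (suc k)) ⟩
    bin (suc n) (suc k) ℕ.+ suc n ℕ.* bin n k ℕ.+ suc n ℕ.* bin n (suc k)
  ≡⟨ ℕP.+-assoc (bin (suc n) (suc k)) _ _ ⟩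
    bin (suc n) (suc k) ℕ.+ (suc n ℕ.* bin n k ℕ.+ suc n ℕ.* bin n (suc k))
  ≡⟨ cong (bin (suc n) (suc k) ℕ.+_) (sym (ℕP.*-distribˡ-+ (suc n) (bin n k) _)) ⟩
    suc (suc n) ℕ.* bin (suc n) (suc k)
  ∎
  where open ≡-Reasoning

bin-absorb-upper : ∀ N A → suc N ℕ.* bin (suc N) A ≡ A ℕ.* bin (suc N) A ℕ.+ suc N ℕ.* bin N A
bin-absorb-upper N zero rewrite bin-n0 N = refl
bin-absorb-upper N (suc a) =
  trans (ℕP.*-distribˡ-+ (suc N) (bin N a) (bin N (suc a)))
        (cong (ℕ._+ suc N ℕ.* bin N (suc a)) (sym (bin-absorb N a)))

deriv : EGF → EGF
deriv f n = f (suc n)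

⊛-bin : ∀ (f g : EGF) n → (f ⊛ g) n ≡ sumUpTo n (λ i → + bin n i * f i * g (n ∸ i))
⊛-bin f g n = sum-cong n (λ i → cong (λ c → + c * f i * g (n ∸ i)) (sym (bin≡C n i)))

⊛-cong : ∀ {f f′ g g′ : EGF} n → (∀ i → f i ≡ f′ i) → (∀ i → g i ≡ g′ i) →
  (f ⊛ g) n ≡ (f′ ⊛ g′) n
⊛-cong n ef eg = sum-cong n (λ i → cong₂ (λ a b → + (n C i) * a * b) (ef i) (eg (n ∸ i)))

⊛-linʳ : ∀ (f g h : EGF) a b n →
  (f ⊛ (λ p → a * g p + b * h p)) n ≡ a * (f ⊛ g) n + b * (f ⊛ h) n
⊛-linʳ f g h a b n =
  trans (sum-cong n (λ i → distrib a b (+ (n C i)) (f i) (g (n ∸ i)) (h (n ∸ i)))) (sum-lin n a b _ _)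
  where distrib : ∀ a b c x y z → c * x * (a * y + b * z) ≡ a * (c * x * y) + b * (c * x * z)
        distrib = solve-∀

⊛-linˡ : ∀ (f g h : EGF) a b n →
  ((λ p → a * g p + b * h p) ⊛ f) n ≡ a * (g ⊛ f) n + b * (h ⊛ f) n
⊛-linˡ f g h a b n =
  trans (sum-cong n (λ i → distrib a b (+ (n C i)) (f (n ∸ i)) (g i) (h i))) (sum-lin n a b _ _)
  where distrib : ∀ a b c x y z → c * (a * y + b * z) * x ≡ a * (c * y * x) + b * (c * z * x)
        distrib = solve-∀

⊛-scaleˡ : ∀ (f g : EGF) a n → ((λ p → a * g p) ⊛ f) n ≡ a * (g ⊛ f) n
⊛-scaleˡ f g a n = trans (sum-cong n (λ i → pull a (+ (n C i)) (g i) (f (n ∸ i)))) (sum-scale n a _)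
  where pull : ∀ a c y z → c * (a * y) * z ≡ a * (c * y * z)
        pull = solve-∀

⊛-zeroʳ : ∀ (f g : EGF) n → (∀ i → i ℕ.≤ n → g i ≡ + 0) → (f ⊛ g) n ≡ + 0
⊛-zeroʳ f g n e = sum-zero n _ (λ i →
  trans (cong (+ (n C i) * f i *_) (e (n ∸ i) (ℕP.m∸n≤m n i))) (ℤP.*-zeroʳ (+ (n C i) * f i)))

⊛-identityˡ : ∀ (g : EGF) n → (oneEGF ⊛ g) n ≡ g n
⊛-identityˡ g n = begin
    (oneEGF ⊛ g) n
  ≡⟨ sum-only-first n _ (λ i → trans (cong (_* g (n ∸ suc i)) (ℤP.*-zeroʳ (+ (n C suc i))))
                                      (ℤP.*-zeroˡ (g (n ∸ suc i)))) ⟩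
    + (n C 0) * + 1 * g n
  ≡⟨ cong (λ c → + c * + 1 * g n) (trans (sym (bin≡C n 0)) (bin-n0 n)) ⟩
    + 1 * + 1 * g n
  ≡⟨ ℤP.*-identityˡ (g n) ⟩
    g n
  ∎
  where open ≡-Reasoning

⊛-leibniz : ∀ (f g : EGF) n → deriv (f ⊛ g) n ≡ (deriv f ⊛ g) n + (f ⊛ deriv g) n
⊛-leibniz f g n = begin
    (f ⊛ g) (suc n)
  ≡⟨ ⊛-bin f g (suc n) ⟩
    sumUpTo (suc n) (λ i → + bin (suc n) i * f i * g (suc n ∸ i))
  ≡⟨ sum-first n _ ⟩
    + 1 * f 0 * g (suc n) + sumUpTo n (λ i → + (bin n i ℕ.+ bin n (suc i)) * f (suc i) * g (n ∸ i))
  ≡⟨ cong (λ z → + 1 * f 0 * g (suc n) + z) (trans (sum-cong n (λ i → pascal (bin n i) (bin n (suc i)) (f (suc i)) (g (n ∸ i))))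
                                            (sum-+ n _ _)) ⟩
    + 1 * f 0 * g (suc n) + (R + S)
  ≡⟨ rotate (+ 1 * f 0 * g (suc n)) R S ⟩
    R + (+ 1 * f 0 * g (suc n) + S)
  ≡⟨ cong₂ _+_ (sym (⊛-bin (deriv f) g n)) second ⟩
    (deriv f ⊛ g) n + (f ⊛ deriv g) n
  ∎
  where
    open ≡-Reasoning
    rotate : ∀ x a b → x + (a + b) ≡ a + (x + b)
    rotate = solve-∀
    pascal : ∀ a b x y → + (a ℕ.+ b) * x * y ≡ + a * x * y + + b * x * y
    pascal a b x y = trans (cong (λ z → z * x * y) (ℤP.pos-+ a b)) (distrib (+ a) (+ b) x y)
      where distrib : ∀ p q x y → (p + q) * x * y ≡ p * x * y + q * x * y
            distrib = solve-∀
    -- the two halves of the sum produced by Pascal's rule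
    R S : ℤ
    R = sumUpTo n (λ i → + bin n i * f (suc i) * g (n ∸ i))
    S = sumUpTo n (λ i → + bin n (suc i) * f (suc i) * g (n ∸ i))
    U : ℕ → ℤ
    U i = + bin n i * f i * g (suc n ∸ i)
    lastU : U (suc n) ≡ + 0
    lastU rewrite bin-vanish n (suc n) ℕP.≤-refl = ℤP.*-zeroˡ (g (n ∸ n))
    second : + 1 * f 0 * g (suc n) + S ≡ (f ⊛ deriv g) n
    second = begin
        + 1 * f 0 * g (suc n) + S
      ≡⟨ cong (λ c → + c * f 0 * g (suc n) + S) (sym (bin-n0 n)) ⟩
        U 0 + sumUpTo n (λ i → U (suc i))
      ≡⟨ sym (sum-first n U) ⟩
        sumUpTo n U + U (suc n)
      ≡⟨ cong (λ z → sumUpTo n U + z) lastU ⟩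
        sumUpTo n U + + 0
      ≡⟨ ℤP.+-identityʳ _ ⟩
        sumUpTo n U
      ≡⟨ sum-cong≤ n (λ i le → cong (λ q → + bin n i * f i * g q) (ℕP.+-∸-assoc 1 le)) ⟩
        sumUpTo n (λ i → + bin n i * f i * g (suc (n ∸ i)))
      ≡⟨ sym (⊛-bin f (deriv g) n) ⟩
        (f ⊛ deriv g) n
      ∎

P : ℕ → EGF
P = powEGF oneMinusExpNeg

Y : ℤ → ℕ → EGF
Y x i = expNeg x ⊛ P i

deriv-oneMinusExpNeg : ∀ p → deriv oneMinusExpNeg p ≡ + 1 * oneEGF p + (- + 1) * oneMinusExpNeg p
deriv-oneMinusExpNeg zero    = refl
deriv-oneMinusExpNeg (suc p) = negate ((- + 1) ^ suc p)
  where negate : ∀ x → - ((- + 1) * x) ≡ + 1 * + 0 + (- + 1) * (- x)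
        negate = solve-∀

deriv-P : ∀ i p → deriv (P (suc i)) p ≡ + suc i * P i p + (- + suc i) * P (suc i) p
deriv-P i p = begin
    deriv (P (suc i)) p
  ≡⟨ ⊛-leibniz oneMinusExpNeg (P i) p ⟩
    (deriv oneMinusExpNeg ⊛ P i) p + (oneMinusExpNeg ⊛ deriv (P i)) p
  ≡⟨ cong₂ _+_ firstFactor (secondFactor i) ⟩
    (+ 1 * P i p + (- + 1) * P (suc i) p) + (+ i * P i p + (- + i) * P (suc i) p)
  ≡⟨ collect (+ i) (P i p) (P (suc i) p) ⟩
    + suc i * P i p + (- + suc i) * P (suc i) p
  ∎
  where
    open ≡-Reasoning
    collect : ∀ a x y → (+ 1 * x + (- + 1) * y) + (a * x + (- a) * y) ≡ (+ 1 + a) * x + (- (+ 1 + a)) * y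
    collect = solve-∀
    firstFactor : (deriv oneMinusExpNeg ⊛ P i) p ≡ + 1 * P i p + (- + 1) * P (suc i) p
    firstFactor = begin
        (deriv oneMinusExpNeg ⊛ P i) p
      ≡⟨ ⊛-cong {g = P i} p deriv-oneMinusExpNeg (λ _ → refl) ⟩
        ((λ q → + 1 * oneEGF q + (- + 1) * oneMinusExpNeg q) ⊛ P i) p
      ≡⟨ ⊛-linˡ (P i) oneEGF oneMinusExpNeg (+ 1) (- + 1) p ⟩
        + 1 * (oneEGF ⊛ P i) p + (- + 1) * P (suc i) p
      ≡⟨ cong (λ z → + 1 * z + (- + 1) * P (suc i) p) (⊛-identityˡ (P i) p) ⟩
        + 1 * P i p + (- + 1) * P (suc i) p
      ∎
    secondFactor : ∀ j → (oneMinusExpNeg ⊛ deriv (P j)) p ≡ + j * P j p + (- + j) * P (suc j) p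
    secondFactor zero = trans (⊛-zeroʳ oneMinusExpNeg (deriv (P 0)) p (λ _ _ → refl))
                              (sym (vanish (P 0 p) (P 1 p)))
      where vanish : ∀ x y → + 0 * x + (- + 0) * y ≡ + 0
            vanish = solve-∀
    secondFactor (suc j) = trans (⊛-cong p (λ _ → refl) (deriv-P j))
                                 (⊛-linʳ oneMinusExpNeg (P j) (P (suc j)) (+ suc j) (- + suc j) p)

P-vanish : ∀ i p → p ℕ.< i → P i p ≡ + 0
P-vanish (suc i) zero    _ = trans (cong (_* P i 0) (ℤP.*-zeroʳ (+ (0 C 0)))) (ℤP.*-zeroˡ (P i 0))
P-vanish (suc i) (suc p) (s≤s p<i)
  rewrite deriv-P i p | P-vanish i p p<i | P-vanish (suc i) p (ℕP.m≤n⇒m≤1+n p<i) =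
  cong₂ _+_ (ℤP.*-zeroʳ (+ suc i)) (ℤP.*-zeroʳ (- + suc i))

deriv-Y₀ : ∀ x n → deriv (Y x 0) n ≡ (- x) * Y x 0 n + + 0
deriv-Y₀ x n = trans (⊛-leibniz (expNeg x) (P 0) n)
  (cong₂ _+_ (⊛-scaleˡ (P 0) (expNeg x) (- x) n) (⊛-zeroʳ (expNeg x) (deriv (P 0)) n (λ _ _ → refl)))

deriv-Y : ∀ x i n → deriv (Y x (suc i)) n ≡ (- x) * Y x (suc i) n + (+ suc i * Y x i n + (- + suc i) * Y x (suc i) n)
deriv-Y x i n = trans (⊛-leibniz (expNeg x) (P (suc i)) n)
  (cong₂ _+_ (⊛-scaleˡ (P (suc i)) (expNeg x) (- x) n)
             (trans (⊛-cong {f = expNeg x} n (λ _ → refl) (deriv-P i))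
                    (⊛-linʳ (expNeg x) (P i) (P (suc i)) (+ suc i) (- + suc i) n)))

Y-vanish : ∀ x i n → n ℕ.< i → Y x i n ≡ + 0
Y-vanish x i n n<i = ⊛-zeroʳ (expNeg x) (P i) n (λ j j≤n → P-vanish i j (ℕP.≤-<-trans j≤n n<i))

liQuot-pad : ∀ K p n → p ℕ.≤ n → liQuot K p ≡ sumUpTo n (λ i → (+ suc i) ^ K * P i p)
liQuot-pad K p n p≤n = sym (sum-pad p n _ p≤n (λ i p<i →
  trans (cong ((+ suc i) ^ K *_) (P-vanish i p p<i)) (ℤP.*-zeroʳ ((+ suc i) ^ K))))

polyBernoulli-via-Y : ∀ n K x → polyBernoulliNeg n K x ≡ sumUpTo n (λ i → (+ suc i) ^ K * Y x i n)
polyBernoulli-via-Y n K x = begin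
    sumUpTo n (λ l → + (n C l) * expNeg x l * liQuot K (n ∸ l))
  ≡⟨ sum-cong n (λ l → trans (cong (+ (n C l) * expNeg x l *_) (liQuot-pad K (n ∸ l) n (ℕP.m∸n≤m n l)))
                             (sym (sum-scale n (+ (n C l) * expNeg x l) _))) ⟩
    sumUpTo n (λ l → sumUpTo n (λ i → + (n C l) * expNeg x l * ((+ suc i) ^ K * P i (n ∸ l))))
  ≡⟨ sum-swap n n _ ⟩
    sumUpTo n (λ i → sumUpTo n (λ l → + (n C l) * expNeg x l * ((+ suc i) ^ K * P i (n ∸ l))))
  ≡⟨ sum-cong n (λ i → trans (sum-cong n (λ l → pull (+ (n C l)) (expNeg x l) ((+ suc i) ^ K) (P i (n ∸ l))))
                             (sum-scale n ((+ suc i) ^ K) _)) ⟩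
    sumUpTo n (λ i → (+ suc i) ^ K * Y x i n)
  ∎
  where
    open ≡-Reasoning
    pull : ∀ c e a p → c * e * (a * p) ≡ a * (c * e * p)
    pull = solve-∀

risingℤ : ℤ → ℕ → ℤ
risingℤ x zero    = + 1
risingℤ x (suc m) = risingℤ x m * (x + + m)

rising : ℕ → ℕ → ℕ
rising a zero    = 1
rising a (suc m) = rising a m ℕ.* (a ℕ.+ m)

risingℤ-pos : ∀ a m → risingℤ (+ a) m ≡ + rising a m
risingℤ-pos a zero    = refl
risingℤ-pos a (suc m) =
  trans (cong₂ _*_ (risingℤ-pos a m) (sym (ℤP.pos-+ a m))) (sym (ℤP.pos-* (rising a m) (a ℕ.+ m)))

stirling1-vanish : ∀ m j → m ℕ.< j → stirling1 m j ≡ 0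
stirling1-vanish zero    (suc j) _ = refl
stirling1-vanish (suc m) (suc j) (s≤s m<j)
  rewrite stirling1-vanish m (suc j) (ℕP.m≤n⇒m≤1+n m<j) | stirling1-vanish m j m<j = trans (ℕP.+-identityʳ (m ℕ.* 0)) (ℕP.*-zeroʳ m)

stirling1-m0 : ∀ m → + m * + stirling1 m 0 ≡ + 0
stirling1-m0 zero    = refl
stirling1-m0 (suc m) = ℤP.*-zeroʳ (+ suc m)

stirling1-rising : ∀ m x → sumUpTo m (λ j → + stirling1 m j * x ^ j) ≡ risingℤ x m
stirling1-rising zero    x = refl
stirling1-rising (suc m) x = begin
    sumUpTo (suc m) (λ j → + stirling1 (suc m) j * x ^ j)
  ≡⟨ sum-first m _ ⟩
    + 0 * + 1 + sumUpTo m (λ j → + (m ℕ.* stirling1 m (suc j) ℕ.+ stirling1 m j) * (x * x ^ j))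
  ≡⟨ cong (λ z → + 0 * + 1 + z) (trans (sum-cong m split) (sum-lin m (+ m) x _ _)) ⟩
    + 0 * + 1 + (+ m * sumUpTo m (λ j → F (suc j)) + x * sumUpTo m F)
  ≡⟨ cong₂ (λ u v → + 0 * + 1 + (u + x * v)) shifted (stirling1-rising m x) ⟩
    + 0 * + 1 + (+ m * risingℤ x m + x * risingℤ x m)
  ≡⟨ factor (+ m) x (risingℤ x m) ⟩
    risingℤ x m * (x + + m)
  ∎
  where
    open ≡-Reasoning
    F : ℕ → ℤ
    F j = + stirling1 m j * x ^ j
    factor : ∀ a x r → + 0 * + 1 + (a * r + x * r) ≡ r * (x + a)
    factor = solve-∀
    distrib : ∀ a b c x y → (a * b + c) * (x * y) ≡ a * (b * (x * y)) + x * (c * y)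
    distrib = solve-∀
    split : ∀ j → + (m ℕ.* stirling1 m (suc j) ℕ.+ stirling1 m j) * (x * x ^ j)
                ≡ + m * F (suc j) + x * F j
    split j = trans (cong (_* (x * x ^ j)) (trans (ℤP.pos-+ (m ℕ.* stirling1 m (suc j)) (stirling1 m j))
                                                  (cong (_+ + stirling1 m j) (ℤP.pos-* m (stirling1 m (suc j))))))
                    (distrib (+ m) (+ stirling1 m (suc j)) (+ stirling1 m j) x (x ^ j))
    -- m Σ_j [m over j+1] x^{j+1} = m x^{(m)}: the extra terms j = 0 and j = m+1 vanish
    -- (the first because it carries the factor m [m over 0] = 0).
    shifted : + m * sumUpTo m (λ j → F (suc j)) ≡ + m * risingℤ x m
    shifted = begin
        + m * sumUpTo m (λ j → F (suc j))
      ≡⟨ sym (ℤP.+-identityˡ _) ⟩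
        + 0 + + m * sumUpTo m (λ j → F (suc j))
      ≡⟨ cong (λ z → z + + m * sumUpTo m (λ j → F (suc j))) (sym (stirling1-m0 m)) ⟩
        + m * + stirling1 m 0 + + m * sumUpTo m (λ j → F (suc j))
      ≡⟨ sym (ℤP.*-distribˡ-+ (+ m) _ _) ⟩
        + m * (+ stirling1 m 0 + sumUpTo m (λ j → F (suc j)))
      ≡⟨ cong (λ z → + m * (z + sumUpTo m (λ j → F (suc j)))) (sym (ℤP.*-identityʳ (+ stirling1 m 0))) ⟩
        + m * (F 0 + sumUpTo m (λ j → F (suc j)))
      ≡⟨ cong (+ m *_) (sym (sum-first m F)) ⟩
        + m * (sumUpTo m F + F (suc m))
      ≡⟨ cong (λ z → + m * (sumUpTo m F + z)) lastF ⟩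
        + m * (sumUpTo m F + + 0)
      ≡⟨ cong (+ m *_) (trans (ℤP.+-identityʳ _) (stirling1-rising m x)) ⟩
        + m * risingℤ x m
      ∎
      where
        lastF : F (suc m) ≡ + 0
        lastF rewrite stirling1-vanish m (suc m) ℕP.≤-refl = ℤP.*-zeroˡ (x ^ suc m)

-- markedWords z s n  is the number of words of length n over an alphabet of
-- z unmarked and s marked letters in which every marked letter occurs.
-- The first letter is unmarked, or it is one of the s marked letters, which
-- then counts as unmarked for the rest of the word.
markedWords : ℕ → ℕ → ℕ → ℕ
markedWords z zero    zero    = 1
markedWords z (suc s) zero    = 0
markedWords z zero    (suc n) = z ℕ.* markedWords z zero n
markedWords z (suc s) (suc n) = z ℕ.* markedWords z (suc s) n ℕ.+ suc s ℕ.* markedWords (suc z) s n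

markedWords-vanish : ∀ z s n → n ℕ.< s → markedWords z s n ≡ 0
markedWords-vanish z (suc s) zero    _ = refl
markedWords-vanish z (suc s) (suc n) (s≤s n<s)
  rewrite markedWords-vanish z (suc s) n (ℕP.m≤n⇒m≤1+n n<s) | markedWords-vanish (suc z) s n n<s
  = cong₂ ℕ._+_ (ℕP.*-zeroʳ z) (ℕP.*-zeroʳ (suc s))

pos-*+* : ∀ a x b y → + (a ℕ.* x ℕ.+ b ℕ.* y) ≡ + a * + x + + b * + y
pos-*+* a x b y = trans (ℤP.pos-+ (a ℕ.* x) (b ℕ.* y)) (cong₂ _+_ (ℤP.pos-* a x) (ℤP.pos-* b y))

-- The words over z unmarked and r marked letters starting with a marked letter,
-- weighted by C(i,r):  C(i,r) · r · markedWords (z+1) (r-1) k.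
firstMarked : ℕ → ℕ → ℕ → ℕ → ℤ
firstMarked z k i zero    = + 0
firstMarked z k i (suc r) = + bin i (suc r) * (+ suc r * + markedWords (suc z) r k)

bin-markedWords-suc : ∀ z k i r →
  + bin i r * + markedWords z r (suc k) ≡ + z * (+ bin i r * + markedWords z r k) + firstMarked z k i r
bin-markedWords-suc z k i zero =
  trans (cong (+ bin i 0 *_) (ℤP.pos-* z (markedWords z 0 k))) (swap (+ bin i 0) (+ z) (+ markedWords z 0 k))
  where swap : ∀ a b c → a * (b * c) ≡ b * (a * c) + + 0
        swap = solve-∀
bin-markedWords-suc z k i (suc r) =
  trans (cong (+ bin i (suc r) *_) (pos-*+* z (markedWords z (suc r) k) (suc r) (markedWords (suc z) r k)))
        (distrib (+ bin i (suc r)) (+ z) (+ markedWords z (suc r) k) (+ suc r * + markedWords (suc z) r k))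
  where distrib : ∀ a b c d → a * (b * c + d) ≡ b * (a * c) + a * d
        distrib = solve-∀

-- By absorption  C(i+1,r+1) (r+1) = (i+1) C(i,r).
sum-firstMarked : ∀ z k i →
  sumUpTo (suc i) (firstMarked z k (suc i)) ≡ + suc i * sumUpTo i (λ r → + bin i r * + markedWords (suc z) r k)
sum-firstMarked z k i = begin
    sumUpTo (suc i) (firstMarked z k (suc i))
  ≡⟨ trans (sum-first i _) (ℤP.+-identityˡ _) ⟩
    sumUpTo i (λ r → + bin (suc i) (suc r) * (+ suc r * M r))
  ≡⟨ sum-cong i absorb ⟩
    sumUpTo i (λ r → + suc i * (+ bin i r * M r))
  ≡⟨ sum-scale i (+ suc i) _ ⟩
    + suc i * sumUpTo i (λ r → + bin i r * M r)
  ∎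
  where
    open ≡-Reasoning
    M : ℕ → ℤ
    M r = + markedWords (suc z) r k
    reassoc : ∀ b r f → b * (r * f) ≡ (r * b) * f
    reassoc = solve-∀
    absorb : ∀ r → + bin (suc i) (suc r) * (+ suc r * M r) ≡ + suc i * (+ bin i r * M r)
    absorb r = begin
        + bin (suc i) (suc r) * (+ suc r * M r)
      ≡⟨ reassoc (+ bin (suc i) (suc r)) (+ suc r) (M r) ⟩
        + suc r * + bin (suc i) (suc r) * M r
      ≡⟨ cong (_* M r) (sym (ℤP.pos-* (suc r) (bin (suc i) (suc r)))) ⟩
        + (suc r ℕ.* bin (suc i) (suc r)) * M r
      ≡⟨ cong (λ w → + w * M r) (bin-absorb i r) ⟩
        + (suc i ℕ.* bin i r) * M r
      ≡⟨ cong (_* M r) (ℤP.pos-* (suc i) (bin i r)) ⟩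
        + suc i * + bin i r * M r
      ≡⟨ ℤP.*-assoc (+ suc i) (+ bin i r) (M r) ⟩
        + suc i * (+ bin i r * M r)
      ∎

-- Classifying the words over z + i letters by which r of the last i letters
-- occur:  (z+i)^k = Σ_r C(i,r) markedWords z r k.
pow-markedWords : ∀ k z i → (+ (z ℕ.+ i)) ^ k ≡ sumUpTo i (λ r → + bin i r * + markedWords z r k)
pow-markedWords zero z i = sym (trans (sum-only-first i _ (λ r → ℤP.*-zeroʳ (+ bin i (suc r))))
                                      (cong (λ w → + w * + 1) (bin-n0 i)))
pow-markedWords (suc k) z i = sym (begin
    sumUpTo i (λ r → + bin i r * + markedWords z r (suc k))
  ≡⟨ trans (sum-cong i (bin-markedWords-suc z k i)) (sum-+ i _ _) ⟩
    sumUpTo i (λ r → + z * (+ bin i r * + markedWords z r k)) + sumUpTo i (firstMarked z k i)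
  ≡⟨ cong₂ _+_ (trans (sum-scale i (+ z) _) (cong (+ z *_) (sym (pow-markedWords k z i)))) (firstLetters i) ⟩
    + z * X + + i * X
  ≡⟨ trans (sym (ℤP.*-distribʳ-+ X (+ z) (+ i))) (cong (_* X) (sym (ℤP.pos-+ z i))) ⟩
    + (z ℕ.+ i) * X
  ∎)
  where
    open ≡-Reasoning
    X : ℤ
    X = (+ (z ℕ.+ i)) ^ k
    firstLetters : ∀ i → sumUpTo i (firstMarked z k i) ≡ + i * (+ (z ℕ.+ i)) ^ k
    firstLetters zero     = refl
    firstLetters (suc i′) = begin
        sumUpTo (suc i′) (firstMarked z k (suc i′))
      ≡⟨ sum-firstMarked z k i′ ⟩
        + suc i′ * sumUpTo i′ (λ r → + bin i′ r * + markedWords (suc z) r k)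
      ≡⟨ cong (+ suc i′ *_) (sym (pow-markedWords k (suc z) i′)) ⟩
        + suc i′ * (+ (suc z ℕ.+ i′)) ^ k
      ≡⟨ cong (λ w → + suc i′ * (+ w) ^ k) (sym (ℕP.+-suc z i′)) ⟩
        + suc i′ * (+ (z ℕ.+ suc i′)) ^ k
      ∎

bin-rising : ∀ m i r → bin i r ℕ.* rising (suc i) m ≡ rising (suc r) m ℕ.* bin (i ℕ.+ m) (r ℕ.+ m)
bin-rising zero i r rewrite ℕP.+-identityʳ i | ℕP.+-identityʳ r = ℕP.*-comm (bin i r) 1
bin-rising (suc m) i r = begin
    bin i r ℕ.* (rising (suc i) m ℕ.* suc (i ℕ.+ m))
  ≡⟨ sym (ℕP.*-assoc (bin i r) _ _) ⟩
    bin i r ℕ.* rising (suc i) m ℕ.* suc (i ℕ.+ m)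
  ≡⟨ cong (ℕ._* suc (i ℕ.+ m)) (bin-rising m i r) ⟩
    rising (suc r) m ℕ.* bin (i ℕ.+ m) (r ℕ.+ m) ℕ.* suc (i ℕ.+ m)
  ≡⟨ reorder (rising (suc r) m) (bin (i ℕ.+ m) (r ℕ.+ m)) (suc (i ℕ.+ m)) ⟩
    rising (suc r) m ℕ.* (suc (i ℕ.+ m) ℕ.* bin (i ℕ.+ m) (r ℕ.+ m))
  ≡⟨ cong (rising (suc r) m ℕ.*_) (sym (bin-absorb (i ℕ.+ m) (r ℕ.+ m))) ⟩
    rising (suc r) m ℕ.* (suc (r ℕ.+ m) ℕ.* bin (suc (i ℕ.+ m)) (suc (r ℕ.+ m)))
  ≡⟨ sym (ℕP.*-assoc (rising (suc r) m) _ _) ⟩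
    rising (suc r) m ℕ.* suc (r ℕ.+ m) ℕ.* bin (suc (i ℕ.+ m)) (suc (r ℕ.+ m))
  ≡⟨ cong₂ (λ p q → rising (suc r) m ℕ.* suc (r ℕ.+ m) ℕ.* bin p q) (sym (ℕP.+-suc i m)) (sym (ℕP.+-suc r m)) ⟩
    rising (suc r) m ℕ.* suc (r ℕ.+ m) ℕ.* bin (i ℕ.+ suc m) (r ℕ.+ suc m)
  ∎
  where
    open ≡-Reasoning
    reorder : ∀ a b c → a ℕ.* b ℕ.* c ≡ a ℕ.* (c ℕ.* b)
    reorder = ℕSolver.solve-∀

bin-upper-shift : ∀ i c s →
  suc i ℕ.* bin (suc (i ℕ.+ c)) (s ℕ.+ c) ≡ s ℕ.* bin (suc (i ℕ.+ c)) (s ℕ.+ c) ℕ.+ suc (i ℕ.+ c) ℕ.* bin (i ℕ.+ c) (s ℕ.+ c)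
bin-upper-shift i c s = ℕP.+-cancelʳ-≡ (c ℕ.* X) _ _ (begin
    suc i ℕ.* X ℕ.+ c ℕ.* X
  ≡⟨ sym (ℕP.*-distribʳ-+ X (suc i) c) ⟩
    suc (i ℕ.+ c) ℕ.* X
  ≡⟨ bin-absorb-upper (i ℕ.+ c) (s ℕ.+ c) ⟩
    (s ℕ.+ c) ℕ.* X ℕ.+ suc (i ℕ.+ c) ℕ.* X′
  ≡⟨ regroup s c X (suc (i ℕ.+ c) ℕ.* X′) ⟩
    s ℕ.* X ℕ.+ suc (i ℕ.+ c) ℕ.* X′ ℕ.+ c ℕ.* X
  ∎)
  where
    open ≡-Reasoning
    X X′ : ℕ
    X  = bin (suc (i ℕ.+ c)) (s ℕ.+ c)
    X′ = bin (i ℕ.+ c) (s ℕ.+ c)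
    regroup : ∀ a b x w → (a ℕ.+ b) ℕ.* x ℕ.+ w ≡ a ℕ.* x ℕ.+ w ℕ.+ b ℕ.* x
    regroup = ℕSolver.solve-∀

-- Expanding markedWords in the functions  Y_i = e^{-mt} (1 - e^{-t})^i,  with
-- binomial coefficients whose indices are shifted by  c = u + m:
--   markedWords (u+1) s n = Σ_i C(i+c, s+c) [t^n/n!] Y_i.
module _ (m : ℕ) where

  binShift : ℕ → ℕ → ℕ → ℤ
  binShift u s i = + bin (i ℕ.+ (u ℕ.+ m)) (s ℕ.+ (u ℕ.+ m))

  binShift-upper : ∀ u s i →
    binShift u s (suc i) * + suc i ≡ + s * binShift u s (suc i) + (+ suc i + (+ u + + m)) * binShift u s i
  binShift-upper u s i = begin
      binShift u s (suc i) * + suc i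
    ≡⟨ trans (ℤP.*-comm (binShift u s (suc i)) (+ suc i)) (sym (ℤP.pos-* (suc i) _)) ⟩
      + (suc i ℕ.* bin (suc (i ℕ.+ c)) (s ℕ.+ c))
    ≡⟨ cong +_ (bin-upper-shift i c s) ⟩
      + (s ℕ.* bin (suc (i ℕ.+ c)) (s ℕ.+ c) ℕ.+ suc (i ℕ.+ c) ℕ.* bin (i ℕ.+ c) (s ℕ.+ c))
    ≡⟨ pos-*+* s _ (suc (i ℕ.+ c)) _ ⟩
      + s * binShift u s (suc i) + + suc (i ℕ.+ c) * binShift u s i
    ≡⟨ cong (λ w → + s * binShift u s (suc i) + w * binShift u s i)
            (trans (ℤP.pos-+ (suc i) c) (cong (λ w → + suc i + w) (ℤP.pos-+ u m))) ⟩
      + s * binShift u s (suc i) + (+ suc i + (+ u + + m)) * binShift u s i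
    ∎
    where
      open ≡-Reasoning
      c : ℕ
      c = u ℕ.+ m

  -- Differentiating  Σ_i binShift u s i · Y_i  with  deriv-Y  and regrouping
  -- by  bin-upper-shift  reproduces the recurrence of markedWords.
  binShift-deriv : ∀ n u s →
    sumUpTo (suc n) (λ i → binShift u s i * Y (+ m) i (suc n))
      ≡ sumUpTo n (λ i → (+ suc u * binShift u s i + + s * binShift u s (suc i)) * Y (+ m) i n)
  binShift-deriv n u s = begin
      sumUpTo (suc n) (λ i → K i * Y (+ m) i (suc n))
    ≡⟨ sum-first n _ ⟩
      K 0 * Y (+ m) 0 (suc n) + sumUpTo n (λ i → K (suc i) * Y (+ m) (suc i) (suc n))
    ≡⟨ cong₂ _+_ (trans (cong (K 0 *_) (deriv-Y₀ (+ m) n)) (expand₀ (+ m) (K 0) (Y (+ m) 0 n)))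
                 (trans (sum-cong n (λ i → trans (cong (K (suc i) *_) (deriv-Y (+ m) i n))
                                                 (expand (+ m) (K (suc i)) (+ suc i) (Y (+ m) i n) (Y (+ m) (suc i) n))))
                        (sum-+ n _ _)) ⟩
      stay 0 + (sumUpTo n (λ i → stay (suc i)) + sumUpTo n fromBelow)
    ≡⟨ sym (ℤP.+-assoc (stay 0) _ _) ⟩
      (stay 0 + sumUpTo n (λ i → stay (suc i))) + sumUpTo n fromBelow
    ≡⟨ cong (_+ sumUpTo n fromBelow) (sym (sum-first n stay)) ⟩
      (sumUpTo n stay + stay (suc n)) + sumUpTo n fromBelow
    ≡⟨ cong (λ z → (sumUpTo n stay + z) + sumUpTo n fromBelow) lastStay ⟩
      (sumUpTo n stay + + 0) + sumUpTo n fromBelow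
    ≡⟨ cong (_+ sumUpTo n fromBelow) (ℤP.+-identityʳ (sumUpTo n stay)) ⟩
      sumUpTo n stay + sumUpTo n fromBelow
    ≡⟨ sym (sum-+ n stay fromBelow) ⟩
      sumUpTo n (λ i → stay i + fromBelow i)
    ≡⟨ sum-cong n regroup ⟩
      sumUpTo n (λ i → (+ suc u * K i + + s * K (suc i)) * Y (+ m) i n)
    ∎
    where
      open ≡-Reasoning
      K : ℕ → ℤ
      K = binShift u s
      -- the terms of the differentiated sum that still involve Y_i, resp. come from Y_{i-1}
      stay fromBelow : ℕ → ℤ
      stay i = K i * (- + m - + i) * Y (+ m) i n
      fromBelow i = K (suc i) * + suc i * Y (+ m) i n
      lastStay : stay (suc n) ≡ + 0
      lastStay = trans (cong (K (suc n) * (- + m - + suc n) *_) (Y-vanish (+ m) (suc n) n ℕP.≤-refl))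
                    (ℤP.*-zeroʳ (K (suc n) * (- + m - + suc n)))
      expand₀ : ∀ x k y → k * ((- x) * y + + 0) ≡ k * (- x - + 0) * y
      expand₀ = solve-∀
      expand : ∀ x k a y y′ → k * ((- x) * y′ + (a * y + (- a) * y′)) ≡ k * (- x - a) * y′ + k * a * y
      expand = solve-∀
      collect : ∀ x k k′ a b c y →
        k * (- x - b) * y + (a * k′ + (+ 1 + b + (c + x)) * k) * y ≡ ((+ 1 + c) * k + a * k′) * y
      collect = solve-∀
      regroup : ∀ i → stay i + fromBelow i ≡ (+ suc u * K i + + s * K (suc i)) * Y (+ m) i n
      regroup i = trans (cong (λ w → stay i + w * Y (+ m) i n) (binShift-upper u s i))
                        (collect (+ m) (K i) (K (suc i)) (+ s) (+ i) (+ u) (Y (+ m) i n))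

  -- By induction on n: both sides satisfy the recurrence of markedWords.
  markedWords-via-Y : ∀ n u s → + markedWords (suc u) s n ≡ sumUpTo n (λ i → binShift u s i * Y (+ m) i n)
  markedWords-via-Y zero u zero    = cong (λ w → + w * + 1) (sym (bin-nn (u ℕ.+ m)))
  markedWords-via-Y zero u (suc s) =
    cong (λ w → + w * + 1) (sym (bin-vanish (u ℕ.+ m) (suc s ℕ.+ (u ℕ.+ m)) (s≤s (ℕP.m≤n+m _ s))))
  markedWords-via-Y (suc n) u s = begin
      + markedWords (suc u) s (suc n)
    ≡⟨ recurrence s ⟩
      + suc u * + markedWords (suc u) s n + + s * + markedWords (suc (suc u)) (ℕ.pred s) n
    ≡⟨ cong₂ (λ a b → + suc u * a + + s * b) (markedWords-via-Y n u s) (markedWords-via-Y n (suc u) (ℕ.pred s)) ⟩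
      + suc u * sumUpTo n (λ i → binShift u s i * Y (+ m) i n)
        + + s * sumUpTo n (λ i → binShift (suc u) (ℕ.pred s) i * Y (+ m) i n)
    ≡⟨ sym (sum-lin n (+ suc u) (+ s) _ _) ⟩
      sumUpTo n (λ i → + suc u * (binShift u s i * Y (+ m) i n) + + s * (binShift (suc u) (ℕ.pred s) i * Y (+ m) i n))
    ≡⟨ sum-cong n (λ i → trans (factor (+ suc u) (+ s) (binShift u s i) (binShift (suc u) (ℕ.pred s) i) (Y (+ m) i n))
                               (cong (λ w → (+ suc u * binShift u s i + w) * Y (+ m) i n) (shiftIndex s i))) ⟩
      sumUpTo n (λ i → (+ suc u * binShift u s i + + s * binShift u s (suc i)) * Y (+ m) i n)
    ≡⟨ sym (binShift-deriv n u s) ⟩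
      sumUpTo (suc n) (λ i → binShift u s i * Y (+ m) i (suc n))
    ∎
    where
      open ≡-Reasoning
      factor : ∀ a b k k′ y → a * (k * y) + b * (k′ * y) ≡ (a * k + b * k′) * y
      factor = solve-∀
      -- the recurrence of markedWords, uniformly in s (the second term vanishes for s = 0)
      recurrence : ∀ s → + markedWords (suc u) s (suc n)
                       ≡ + suc u * + markedWords (suc u) s n + + s * + markedWords (suc (suc u)) (ℕ.pred s) n
      recurrence zero    = trans (ℤP.pos-* (suc u) (markedWords (suc u) 0 n)) (sym (ℤP.+-identityʳ _))
      recurrence (suc s) = pos-*+* (suc u) (markedWords (suc u) (suc s) n) (suc s) (markedWords (suc (suc u)) s n)
      -- moving one unmarked letter into the offset shifts the binomial indices
      shiftIndex : ∀ s i → + s * binShift (suc u) (ℕ.pred s) i ≡ + s * binShift u s (suc i)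
      shiftIndex zero    i = trans (ℤP.*-zeroˡ (binShift (suc u) 0 i)) (sym (ℤP.*-zeroˡ (binShift u 0 (suc i))))
      shiftIndex (suc s) i =
        cong (λ w → + suc s * w) (cong₂ (λ p q → + bin p q) (ℕP.+-suc i (u ℕ.+ m)) (ℕP.+-suc s (u ℕ.+ m)))

-- 𝓑_n^{(-k)}(m) = Σ_{i ≤ n} (i+1)^k (i+1)^{(m)} [t^n/n!] e^{-mt} (1 - e^{-t})^i:
-- the Stirling sum over j collapses to a rising factorial.
symPolyBernoulli-via-Y : ∀ n k m →
  symPolyBernoulli n k m ≡ sumUpTo n (λ i → (+ suc i) ^ k * risingℤ (+ suc i) m * Y (+ m) i n)
symPolyBernoulli-via-Y n k m = begin
    sumUpTo m (λ j → + stirling1 m j * polyBernoulliNeg n (k ℕ.+ j) (+ m))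
  ≡⟨ sum-cong m (λ j → trans (cong (+ stirling1 m j *_) (polyBernoulli-via-Y n (k ℕ.+ j) (+ m)))
                             (sym (sum-scale n (+ stirling1 m j) _))) ⟩
    sumUpTo m (λ j → sumUpTo n (λ i → + stirling1 m j * ((+ suc i) ^ (k ℕ.+ j) * Y (+ m) i n)))
  ≡⟨ sum-swap m n _ ⟩
    sumUpTo n (λ i → sumUpTo m (λ j → + stirling1 m j * ((+ suc i) ^ (k ℕ.+ j) * Y (+ m) i n)))
  ≡⟨ sum-cong n stirlingSum ⟩
    sumUpTo n (λ i → (+ suc i) ^ k * risingℤ (+ suc i) m * Y (+ m) i n)
  ∎
  where
    open ≡-Reasoning
    reorder : ∀ s a b y → s * (a * b * y) ≡ a * y * (s * b)
    reorder = solve-∀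
    swapLast : ∀ a y r → a * y * r ≡ a * r * y
    swapLast = solve-∀
    stirlingSum : ∀ i → sumUpTo m (λ j → + stirling1 m j * ((+ suc i) ^ (k ℕ.+ j) * Y (+ m) i n))
                      ≡ (+ suc i) ^ k * risingℤ (+ suc i) m * Y (+ m) i n
    stirlingSum i = begin
        sumUpTo m (λ j → + stirling1 m j * ((+ suc i) ^ (k ℕ.+ j) * Y (+ m) i n))
      ≡⟨ sum-cong m (λ j → trans (cong (λ w → + stirling1 m j * (w * Y (+ m) i n)) (ℤP.^-distribˡ-+-* (+ suc i) k j))
                                 (reorder (+ stirling1 m j) ((+ suc i) ^ k) ((+ suc i) ^ j) (Y (+ m) i n))) ⟩
        sumUpTo m (λ j → (+ suc i) ^ k * Y (+ m) i n * (+ stirling1 m j * (+ suc i) ^ j))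
      ≡⟨ sum-scale m ((+ suc i) ^ k * Y (+ m) i n) _ ⟩
        (+ suc i) ^ k * Y (+ m) i n * sumUpTo m (λ j → + stirling1 m j * (+ suc i) ^ j)
      ≡⟨ cong ((+ suc i) ^ k * Y (+ m) i n *_) (stirling1-rising m (+ suc i)) ⟩
        (+ suc i) ^ k * Y (+ m) i n * risingℤ (+ suc i) m
      ≡⟨ swapLast ((+ suc i) ^ k) (Y (+ m) i n) (risingℤ (+ suc i) m) ⟩
        (+ suc i) ^ k * risingℤ (+ suc i) m * Y (+ m) i n
      ∎

sumℕ : ℕ → (ℕ → ℕ) → ℕ
sumℕ zero    c = c 0
sumℕ (suc B) c = c 0 ℕ.+ sumℕ B (λ i → c (suc i))

sumℕ-pos : ∀ B c → + sumℕ B c ≡ sumUpTo B (λ i → + c i)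
sumℕ-pos zero    c = refl
sumℕ-pos (suc B) c = begin
    + (c 0 ℕ.+ sumℕ B (λ i → c (suc i)))
  ≡⟨ ℤP.pos-+ (c 0) _ ⟩
    + c 0 + + sumℕ B (λ i → c (suc i))
  ≡⟨ cong (λ z → + c 0 + z) (sumℕ-pos B (λ i → c (suc i))) ⟩
    + c 0 + sumUpTo B (λ i → + c (suc i))
  ≡⟨ sym (sum-first B (λ i → + c i)) ⟩
    sumUpTo (suc B) (λ i → + c i)
  ∎
  where open ≡-Reasoning

sumℕ-cong : ∀ B {c d : ℕ → ℕ} → (∀ i → c i ≡ d i) → sumℕ B c ≡ sumℕ B d
sumℕ-cong zero    e = e 0
sumℕ-cong (suc B) e = cong₂ ℕ._+_ (e 0) (sumℕ-cong B (λ i → e (suc i)))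

callanTerm : ℕ → ℕ → ℕ → ℕ → ℕ
callanTerm n k m r = markedWords 1 r n ℕ.* markedWords 1 r k ℕ.* rising (suc r) m

-- Summing over  r ≤ n + k  (beyond that there are no such sequences).
callanCount : ℕ → ℕ → ℕ → ℕ
callanCount n k m = sumℕ (n ℕ.+ k) (callanTerm n k m)

callanCount-sym : ∀ n k m → callanCount n k m ≡ callanCount k n m
callanCount-sym n k m =
  trans (cong (λ B → sumℕ B (callanTerm n k m)) (ℕP.+-comm n k))
        (sumℕ-cong (k ℕ.+ n) (λ r → cong (ℕ._* rising (suc r) m) (ℕP.*-comm (markedWords 1 r n) (markedWords 1 r k))))

rising-across-bin : ∀ m i r → + bin i r * risingℤ (+ suc i) m ≡ + rising (suc r) m * binShift m 0 r i
rising-across-bin m i r = begin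
    + bin i r * risingℤ (+ suc i) m
  ≡⟨ cong (+ bin i r *_) (risingℤ-pos (suc i) m) ⟩
    + bin i r * + rising (suc i) m
  ≡⟨ sym (ℤP.pos-* (bin i r) _) ⟩
    + (bin i r ℕ.* rising (suc i) m)
  ≡⟨ cong +_ (bin-rising m i r) ⟩
    + (rising (suc r) m ℕ.* bin (i ℕ.+ m) (r ℕ.+ m))
  ≡⟨ ℤP.pos-* (rising (suc r) m) _ ⟩
    + rising (suc r) m * binShift m 0 r i
  ∎
  where open ≡-Reasoning

summand-expansion : ∀ n k m i → i ℕ.≤ n →
  (+ suc i) ^ k * risingℤ (+ suc i) m * Y (+ m) i n
    ≡ sumUpTo n (λ r → + markedWords 1 r k * (+ rising (suc r) m * (binShift m 0 r i * Y (+ m) i n)))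
summand-expansion n k m i i≤n = begin
    (+ suc i) ^ k * ρ * y
  ≡⟨ cong (λ w → w * ρ * y) (trans (pow-markedWords k 1 i) (sym (sum-pad i n _ i≤n (λ r i<r →
       cong (λ w → + w * W r) (bin-vanish i r i<r))))) ⟩
    sumUpTo n (λ r → + bin i r * W r) * ρ * y
  ≡⟨ trans (ℤP.*-assoc (sumUpTo n (λ r → + bin i r * W r)) ρ y)
           (trans (ℤP.*-comm (sumUpTo n (λ r → + bin i r * W r)) (ρ * y)) (sym (sum-scale n (ρ * y) _))) ⟩
    sumUpTo n (λ r → ρ * y * (+ bin i r * W r))
  ≡⟨ sum-cong n (λ r → trans (reorder ρ y (+ bin i r) (W r))
                             (cong (λ w → W r * (w * y)) (rising-across-bin m i r))) ⟩
    sumUpTo n (λ r → W r * ((+ rising (suc r) m * binShift m 0 r i) * y))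
  ≡⟨ sum-cong n (λ r → cong (W r *_) (ℤP.*-assoc (+ rising (suc r) m) (binShift m 0 r i) y)) ⟩
    sumUpTo n (λ r → W r * (+ rising (suc r) m * (binShift m 0 r i * y)))
  ∎
  where
    open ≡-Reasoning
    ρ y : ℤ
    ρ = risingℤ (+ suc i) m
    y = Y (+ m) i n
    W : ℕ → ℤ
    W r = + markedWords 1 r k
    reorder : ∀ p y b f → p * y * (b * f) ≡ f * ((b * p) * y)
    reorder = solve-∀

callanCount≡symPolyBernoulli : ∀ n k m → + callanCount n k m ≡ symPolyBernoulli n k m
callanCount≡symPolyBernoulli n k m = sym (begin
    symPolyBernoulli n k m
  ≡⟨ symPolyBernoulli-via-Y n k m ⟩
    sumUpTo n (λ i → (+ suc i) ^ k * risingℤ (+ suc i) m * Y (+ m) i n)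
  ≡⟨ sum-cong≤ n (summand-expansion n k m) ⟩
    sumUpTo n (λ i → sumUpTo n (λ r → W r * (R r * (binShift m 0 r i * Y (+ m) i n))))
  ≡⟨ sum-swap n n _ ⟩
    sumUpTo n (λ r → sumUpTo n (λ i → W r * (R r * (binShift m 0 r i * Y (+ m) i n))))
  ≡⟨ sum-cong n (λ r → trans (sum-scale n (W r) _) (cong (W r *_)
                       (trans (sum-scale n (R r) _) (cong (R r *_) (sym (markedWords-via-Y m n 0 r)))))) ⟩
    sumUpTo n (λ r → W r * (R r * + markedWords 1 r n))
  ≡⟨ sum-cong n toTerm ⟩
    sumUpTo n (λ r → + callanTerm n k m r)
  ≡⟨ sym (sum-pad n (n ℕ.+ k) _ (ℕP.m≤m+n n k) (λ r n<r →
       cong (λ w → + (w ℕ.* markedWords 1 r k ℕ.* rising (suc r) m)) (markedWords-vanish 1 r n n<r))) ⟩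
    sumUpTo (n ℕ.+ k) (λ r → + callanTerm n k m r)
  ≡⟨ sym (sumℕ-pos (n ℕ.+ k) (callanTerm n k m)) ⟩
    + callanCount n k m
  ∎)
  where
    open ≡-Reasoning
    W R : ℕ → ℤ
    W r = + markedWords 1 r k
    R r = + rising (suc r) m
    toTerm : ∀ r → W r * (R r * + markedWords 1 r n) ≡ + callanTerm n k m r
    toTerm r = begin
        W r * (R r * + markedWords 1 r n)
      ≡⟨ rotate (W r) (R r) (+ markedWords 1 r n) ⟩
        + markedWords 1 r n * W r * R r
      ≡⟨ cong (_* R r) (sym (ℤP.pos-* (markedWords 1 r n) (markedWords 1 r k))) ⟩
        + (markedWords 1 r n ℕ.* markedWords 1 r k) * R r
      ≡⟨ sym (ℤP.pos-* (markedWords 1 r n ℕ.* markedWords 1 r k) _) ⟩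
        + callanTerm n k m r
      ∎
      where rotate : ∀ a b c → a * (b * c) ≡ c * a * b
            rotate = solve-∀

Σ-↔ : ∀ {I : Set} {A B : I → Set} → (∀ i → A i ↔ B i) → Σ I A ↔ Σ I B
Σ-↔ e = ΣP.congˡ {k = bijection} (λ {i} → e i)

Fin-≡ : ∀ {a b} → a ≡ b → Fin a ↔ Fin b
Fin-≡ refl = ↔-refl

empty↔ : ∀ {A : Set} → (A → ⊥) → A ↔ Fin 0
empty↔ f = mk↔ₛ′ (λ a → ⊥-elim (f a)) (λ ()) (λ ()) (λ a → ⊥-elim (f a))

⊎-empty : ∀ {A B : Set} → (B → ⊥) → (A ⊎ B) ↔ A
⊎-empty f = mk↔ₛ′ (λ { (inj₁ a) → a ; (inj₂ b) → ⊥-elim (f b) }) inj₁ (λ _ → refl)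
                  (λ { (inj₁ a) → refl ; (inj₂ b) → ⊥-elim (f b) })

ind : Bool → ℕ
ind b = if b then 1 else 0

T↔ : ∀ b → T b ↔ Fin (ind b)
T↔ true  = mk↔ₛ′ (λ _ → zero) (λ _ → tt) (λ { zero → refl }) (λ _ → refl)
T↔ false = empty↔ (λ ())

T-≡ : ∀ {b c} → b ≡ c → T b ↔ T c
T-≡ refl = ↔-refl

Σ-Fin-first : ∀ {n} {F : Fin (suc n) → Set} → Σ (Fin (suc n)) F ↔ (F zero ⊎ Σ (Fin n) (λ i → F (suc i)))
Σ-Fin-first = mk↔ₛ′ (λ { (zero , p) → inj₁ p ; (suc i , p) → inj₂ (i , p) })
                    (λ { (inj₁ p) → zero , p ; (inj₂ (i , p)) → suc i , p })
                    (λ { (inj₁ p) → refl ; (inj₂ (i , p)) → refl })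
                    (λ { (zero , p) → refl ; (suc i , p) → refl })

Σ-ℕ-first : ∀ {F : ℕ → Set} → Σ ℕ F ↔ (F zero ⊎ Σ ℕ (λ i → F (suc i)))
Σ-ℕ-first = mk↔ₛ′ (λ { (zero , p) → inj₁ p ; (suc i , p) → inj₂ (i , p) })
                  (λ { (inj₁ p) → zero , p ; (inj₂ (i , p)) → suc i , p })
                  (λ { (inj₁ p) → refl ; (inj₂ (i , p)) → refl })
                  (λ { (zero , p) → refl ; (suc i , p) → refl })

sumFin : ∀ n → (Fin n → ℕ) → ℕ
sumFin zero    f = 0
sumFin (suc n) f = f zero ℕ.+ sumFin n (λ i → f (suc i))

Σ-Fin↔ : ∀ n (f : Fin n → ℕ) → Σ (Fin n) (λ i → Fin (f i)) ↔ Fin (sumFin n f)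
Σ-Fin↔ zero    f = empty↔ (λ { (() , _) })
Σ-Fin↔ (suc n) f = ↔-trans Σ-Fin-first (↔-trans (↔-refl ⊎-↔ Σ-Fin↔ n (λ i → f (suc i))) (↔-sym FinP.+↔⊎))

allF : ∀ r → (Fin r → Bool) → Bool
allF zero    p = true
allF (suc r) p = p zero ∧ allF r (λ j → p (suc j))

all-allF : ∀ r (p : Fin r → Bool) → all p (allFin r) ≡ allF r p
all-allF r p = go r (λ j → j)
  where
    go : ∀ r′ (f : Fin r′ → Fin r) → all p (tabulate f) ≡ allF r′ (λ j → p (f j))
    go zero     f = refl
    go (suc r′) f = cong (p (f zero) ∧_) (go r′ (λ j → f (suc j)))

allF-cong : ∀ r {p q : Fin r → Bool} → (∀ j → p j ≡ q j) → allF r p ≡ allF r q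
allF-cong zero    e = refl
allF-cong (suc r) e = cong₂ _∧_ (e zero) (allF-cong r (λ j → e (suc j)))

countTrue countFalse : ∀ r → (Fin r → Bool) → ℕ
countTrue  zero    t = 0
countTrue  (suc r) t = ind (t zero) ℕ.+ countTrue r (λ j → t (suc j))
countFalse zero    t = 0
countFalse (suc r) t = ind (not (t zero)) ℕ.+ countFalse r (λ j → t (suc j))

countTrue-cong : ∀ r {p q : Fin r → Bool} → (∀ j → p j ≡ q j) → countTrue r p ≡ countTrue r q
countTrue-cong zero    e = refl
countTrue-cong (suc r) e = cong₂ (λ a b → ind a ℕ.+ b) (e zero) (countTrue-cong r (λ j → e (suc j)))

countTrue+countFalse : ∀ r t → countTrue r t ℕ.+ countFalse r t ≡ r
countTrue+countFalse zero    t = refl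
countTrue+countFalse (suc r) t with t zero
... | true  = cong suc (countTrue+countFalse r (λ j → t (suc j)))
... | false = trans (ℕP.+-suc (countTrue r (λ j → t (suc j))) _) (cong suc (countTrue+countFalse r (λ j → t (suc j))))

countTrue-all : ∀ r → countTrue r (λ _ → true) ≡ r
countTrue-all zero    = refl
countTrue-all (suc r) = cong suc (countTrue-all r)

isZero : ℕ → Bool
isZero zero    = true
isZero (suc _) = false

allF-not : ∀ r t → allF r (λ j → not (t j)) ≡ isZero (countTrue r t)
allF-not zero    t = refl
allF-not (suc r) t with t zero
... | true  = refl
... | false = allF-not r (λ j → t (suc j))

clearAt : ∀ {r} → Fin r → (Fin r → Bool) → Fin r → Bool
clearAt i t j = t j ∧ not (does (i Fin.≟ j))

-- Clearing a true position lowers the count by one, clearing a false one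
-- keeps it; summing any  h (t i) (count after clearing i)  over all i:
sum-clearAt : ∀ r (t : Fin r → Bool) (h : Bool → ℕ → ℕ) →
  sumFin r (λ i → h (t i) (countTrue r (clearAt i t)))
    ≡ countTrue r t ℕ.* h true (pred (countTrue r t)) ℕ.+ countFalse r t ℕ.* h false (countTrue r t)
sum-clearAt zero t h = refl
sum-clearAt (suc r) t h with t zero
... | true = begin
      h true (countTrue r (λ j → t (suc j) ∧ true)) ℕ.+ sumFin r (λ i → h (t (suc i)) (suc (countTrue r (clearAt i t′))))
    ≡⟨ cong₂ ℕ._+_ (cong (h true) clear0) (sum-clearAt r t′ (λ b x → h b (suc x))) ⟩
      h true c ℕ.+ (c ℕ.* h true (suc (pred c)) ℕ.+ countFalse r t′ ℕ.* h false (suc c))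
    ≡⟨ cong (λ w → h true c ℕ.+ (w ℕ.+ countFalse r t′ ℕ.* h false (suc c))) (sucPred c) ⟩
      h true c ℕ.+ (c ℕ.* h true c ℕ.+ countFalse r t′ ℕ.* h false (suc c))
    ≡⟨ sym (ℕP.+-assoc (h true c) _ _) ⟩
      suc c ℕ.* h true c ℕ.+ countFalse r t′ ℕ.* h false (suc c)
    ∎
  where
    open ≡-Reasoning
    t′ : Fin r → Bool
    t′ j = t (suc j)
    c : ℕ
    c = countTrue r t′
    clear0 : countTrue r (λ j → t (suc j) ∧ true) ≡ c
    clear0 = countTrue-cong r (λ j → BoolP.∧-identityʳ (t (suc j)))
    sucPred : ∀ a → a ℕ.* h true (suc (pred a)) ≡ a ℕ.* h true a
    sucPred zero    = refl
    sucPred (suc a) = refl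
... | false = begin
      h false (countTrue r (λ j → t (suc j) ∧ true)) ℕ.+ sumFin r (λ i → h (t (suc i)) (countTrue r (clearAt i t′)))
    ≡⟨ cong₂ ℕ._+_ (cong (h false) clear0) (sum-clearAt r t′ h) ⟩
      h false c ℕ.+ (c ℕ.* h true (pred c) ℕ.+ countFalse r t′ ℕ.* h false c)
    ≡⟨ swap (h false c) (c ℕ.* h true (pred c)) (countFalse r t′ ℕ.* h false c) ⟩
      c ℕ.* h true (pred c) ℕ.+ (h false c ℕ.+ countFalse r t′ ℕ.* h false c)
    ∎
  where
    open ≡-Reasoning
    t′ : Fin r → Bool
    t′ j = t (suc j)
    c : ℕ
    c = countTrue r t′
    clear0 : countTrue r (λ j → t (suc j) ∧ true) ≡ c
    clear0 = countTrue-cong r (λ j → BoolP.∧-identityʳ (t (suc j)))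
    swap : ∀ a b c → a ℕ.+ (b ℕ.+ c) ≡ b ℕ.+ (a ℕ.+ c)
    swap = ℕSolver.solve-∀

hitsNeeded : ∀ {r n} → (Fin r → Bool) → Vec (Fin (suc r)) n → Bool
hitsNeeded {r} need v = all (λ j → not (need j) ∨ hits v j) (allFin r)

Assignments : (r n : ℕ) → (Fin r → Bool) → Set
Assignments r n need = Σ (Vec (Fin (suc r)) n) (λ v → T (hitsNeeded {r} need v))

-- Assigning the first element to block x satisfies the need of block x.
satisfy : ∀ {r} → Fin (suc r) → (Fin r → Bool) → Fin r → Bool
satisfy x need j = need j ∧ not (does (x Fin.≟ suc j))

hitsNeeded-∷ : ∀ {r n} (need : Fin r → Bool) x (v : Vec (Fin (suc r)) n) →
  hitsNeeded need (x ∷ v) ≡ hitsNeeded (satisfy x need) v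
hitsNeeded-∷ {r} need x v =
  trans (all-allF r _) (trans (allF-cong r (λ j → pointwise (need j) (does (x Fin.≟ suc j)) (hits v j))) (sym (all-allF r _)))
  where pointwise : ∀ a e h → not a ∨ (e ∨ h) ≡ not (a ∧ not e) ∨ h
        pointwise true  true  h = refl
        pointwise true  false h = refl
        pointwise false e     h = refl

hitsNeeded-[] : ∀ {r} (need : Fin r → Bool) → hitsNeeded need [] ≡ isZero (countTrue r need)
hitsNeeded-[] {r} need =
  trans (all-allF r _) (trans (allF-cong r (λ j → BoolP.∨-identityʳ (not (need j)))) (allF-not r need))

-- With t needed blocks, the other  r + 1 - t  blocks are unmarked letters.
assignmentCount : ℕ → ℕ → ℕ → ℕ
assignmentCount r n t = markedWords (suc (r ∸ t)) t n

-- Choosing the block of the first element: the recurrence of markedWords.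
sum-assignmentCount : ∀ r n (need : Fin r → Bool) →
  sumFin (suc r) (λ x → assignmentCount r n (countTrue r (satisfy x need)))
    ≡ assignmentCount r (suc n) (countTrue r need)
sum-assignmentCount r n need = begin
    A (countTrue r (satisfy zero need)) ℕ.+ sumFin r (λ i → A (countTrue r (clearAt i need)))
  ≡⟨ cong₂ ℕ._+_ (cong A (countTrue-cong r (λ j → BoolP.∧-identityʳ (need j)))) (sum-clearAt r need (λ _ → A)) ⟩
    A t ℕ.+ (t ℕ.* A (pred t) ℕ.+ countFalse r need ℕ.* A t)
  ≡⟨ cong (λ w → A t ℕ.+ (t ℕ.* A (pred t) ℕ.+ w ℕ.* A t)) unneeded ⟩
    A t ℕ.+ (t ℕ.* A (pred t) ℕ.+ (r ∸ t) ℕ.* A t)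
  ≡⟨ recurrence t refl ⟩
    assignmentCount r (suc n) t
  ∎
  where
    open ≡-Reasoning
    A : ℕ → ℕ
    A = assignmentCount r n
    t : ℕ
    t = countTrue r need
    unneeded : countFalse r need ≡ r ∸ t
    unneeded = sym (trans (cong (_∸ t) (sym (countTrue+countFalse r need))) (ℕP.m+n∸m≡n t (countFalse r need)))
    t≤r : t ℕ.≤ r
    t≤r = subst (t ℕ.≤_) (countTrue+countFalse r need) (ℕP.m≤m+n t (countFalse r need))
    regroup : ∀ a b c → a ℕ.+ (b ℕ.+ c ℕ.* a) ≡ a ℕ.+ c ℕ.* a ℕ.+ b
    regroup = ℕSolver.solve-∀
    recurrence : ∀ s → s ≡ t → A s ℕ.+ (s ℕ.* A (pred s) ℕ.+ (r ∸ s) ℕ.* A s) ≡ assignmentCount r (suc n) s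
    recurrence zero    _ = refl
    recurrence (suc s) e =
      trans (cong (λ z → A (suc s) ℕ.+ (suc s ℕ.* markedWords (suc z) s n ℕ.+ (r ∸ suc s) ℕ.* A (suc s))) r∸s)
            (regroup (A (suc s)) (suc s ℕ.* markedWords (suc (suc (r ∸ suc s))) s n) (r ∸ suc s))
      where
        r∸s : r ∸ s ≡ suc (r ∸ suc s)
        r∸s = ℕP.+-∸-assoc 1 (subst (ℕ._≤ r) (sym e) t≤r)

Assignments-∷ : ∀ r n need → Assignments r (suc n) need ↔ Σ (Fin (suc r)) (λ x → Assignments r n (satisfy x need))
Assignments-∷ r n need = mk↔ₛ′
  (λ { (x ∷ v , p) → x , (v , subst T (hitsNeeded-∷ need x v) p) })
  (λ { (x , (v , q)) → (x ∷ v) , subst T (sym (hitsNeeded-∷ need x v)) q })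
  (λ { (x , (v , q)) → cong (λ z → x , (v , z)) (BoolP.T-irrelevant _ _) })
  (λ { (x ∷ v , p) → cong (λ z → (x ∷ v) , z) (BoolP.T-irrelevant _ _) })

Assignments↔ : ∀ r n need → Assignments r n need ↔ Fin (assignmentCount r n (countTrue r need))
Assignments↔ r zero need =
  ↔-trans (mk↔ₛ′ (λ { ([] , p) → p }) (λ p → [] , p) (λ _ → refl) (λ { ([] , p) → refl }))
    (↔-trans (T-≡ (hitsNeeded-[] need)) (↔-trans (T↔ (isZero (countTrue r need))) (Fin-≡ (base (countTrue r need)))))
  where base : ∀ t → ind (isZero t) ≡ assignmentCount r 0 t
        base zero    = refl
        base (suc t) = refl
Assignments↔ r (suc n) need =
  ↔-trans (Assignments-∷ r n need)
    (↔-trans (Σ-↔ (λ x → Assignments↔ r n (satisfy x need)))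
      (↔-trans (Σ-Fin↔ (suc r) _) (Fin-≡ (sum-assignmentCount r n need))))

blockAssignments↔ : ∀ r n → Σ (Vec (Fin (suc r)) n) (λ v → T (ordinaryBlocksNonempty v)) ↔ Fin (markedWords 1 r n)
blockAssignments↔ r n =
  ↔-trans (Assignments↔ r n (λ _ → true))
          (Fin-≡ (trans (cong (assignmentCount r n) (countTrue-all r)) (cong (λ z → markedWords (suc z) r n) (ℕP.n∸n≡0 r))))

falling : ℕ → ℕ → ℕ
falling l       zero    = 1
falling zero    (suc s) = 0
falling (suc l) (suc s) = suc l ℕ.* falling l s

falling-suc : ∀ l s → falling l (suc s) ℕ.+ suc s ℕ.* falling l s ≡ suc l ℕ.* falling l s
falling-suc zero    zero    = refl
falling-suc zero    (suc s) = ℕP.*-zeroʳ s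
falling-suc (suc l) zero    = arith l
  where arith : ∀ l → suc l ℕ.* 1 ℕ.+ 1 ℕ.* 1 ≡ suc (suc l) ℕ.* 1
        arith = ℕSolver.solve-∀
falling-suc (suc l) (suc s) = begin
    suc l ℕ.* falling l (suc s) ℕ.+ suc (suc s) ℕ.* (suc l ℕ.* falling l s)
  ≡⟨ factor (suc l) (falling l (suc s)) (suc s) (falling l s) ⟩
    suc l ℕ.* (falling l (suc s) ℕ.+ suc s ℕ.* falling l s) ℕ.+ suc l ℕ.* falling l s
  ≡⟨ cong (λ z → suc l ℕ.* z ℕ.+ suc l ℕ.* falling l s) (falling-suc l s) ⟩
    suc l ℕ.* (suc l ℕ.* falling l s) ℕ.+ suc l ℕ.* falling l s
  ≡⟨ ℕP.+-comm (suc l ℕ.* (suc l ℕ.* falling l s)) _ ⟩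
    suc (suc l) ℕ.* (suc l ℕ.* falling l s)
  ∎
  where
    open ≡-Reasoning
    factor : ∀ a x b y → a ℕ.* x ℕ.+ suc b ℕ.* (a ℕ.* y) ≡ a ℕ.* (x ℕ.+ b ℕ.* y) ℕ.+ a ℕ.* y
    factor = ℕSolver.solve-∀

falling-rising : ∀ r m → falling (r ℕ.+ m) m ≡ rising (suc r) m
falling-rising r zero    = refl
falling-rising r (suc m) = begin
    falling (r ℕ.+ suc m) (suc m)
  ≡⟨ cong (λ z → falling z (suc m)) (ℕP.+-suc r m) ⟩
    suc (r ℕ.+ m) ℕ.* falling (r ℕ.+ m) m
  ≡⟨ cong (suc (r ℕ.+ m) ℕ.*_) (falling-rising r m) ⟩
    suc (r ℕ.+ m) ℕ.* rising (suc r) m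
  ≡⟨ ℕP.*-comm (suc (r ℕ.+ m)) (rising (suc r) m) ⟩
    rising (suc r) (suc m)
  ∎
  where open ≡-Reasoning

barsExactly : ∀ {m l} → (Fin m → Bool) → Vec (Maybe (Fin m)) l → Bool
barsExactly {m} t w = all (λ b → occurrences b w ≡ᵇ ind (t b)) (allFin m)

BarWords : (m l : ℕ) → (Fin m → Bool) → Set
BarWords m l t = Σ (Vec (Maybe (Fin m)) l) (λ w → T (barsExactly {m} t w))

occurrences-just : ∀ {m l} (c b : Fin m) (w : Vec (Maybe (Fin m)) l) →
  occurrences b (just c ∷ w) ≡ (if does (c Fin.≟ b) then suc (occurrences b w) else occurrences b w)
occurrences-just c b w with does (c Fin.≟ b)
... | true  = refl
... | false = refl

barsExactly-pointwise : ∀ {m l} (t : Fin m → Bool) (c b : Fin m) (w : Vec (Maybe (Fin m)) l) →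
  (occurrences b (just c ∷ w) ≡ᵇ ind (t b))
    ≡ (not (does (c Fin.≟ b)) ∨ t c) ∧ (occurrences b w ≡ᵇ ind (clearAt c t b))
barsExactly-pointwise t c b w rewrite occurrences-just c b w with c Fin.≟ b
... | yes refl with t c
...   | true  = refl
...   | false = refl
barsExactly-pointwise t c b w | no _ = cong (λ x → occurrences b w ≡ᵇ ind x) (sym (BoolP.∧-identityʳ (t b)))

allF-∧ : ∀ r (p q : Fin r → Bool) → allF r (λ j → p j ∧ q j) ≡ allF r p ∧ allF r q
allF-∧ zero    p q = refl
allF-∧ (suc r) p q rewrite allF-∧ r (λ j → p (suc j)) (λ j → q (suc j)) with p zero | q zero
... | true  | true  = refl
... | true  | false = sym (BoolP.∧-zeroʳ _)
... | false | _     = refl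

allF-true : ∀ r → allF r (λ _ → true) ≡ true
allF-true zero    = refl
allF-true (suc r) = allF-true r

allF-at : ∀ r (c : Fin r) a → allF r (λ b → not (does (c Fin.≟ b)) ∨ a) ≡ a
allF-at (suc r) zero    a = trans (cong (a ∧_) (allF-true r)) (BoolP.∧-identityʳ a)
allF-at (suc r) (suc c) a = allF-at r c a

barsExactly-just : ∀ {m l} (t : Fin m → Bool) c (w : Vec (Maybe (Fin m)) l) →
  barsExactly t (just c ∷ w) ≡ t c ∧ barsExactly (clearAt c t) w
barsExactly-just {m} t c w = begin
    barsExactly t (just c ∷ w)
  ≡⟨ all-allF m _ ⟩
    allF m (λ b → occurrences b (just c ∷ w) ≡ᵇ ind (t b))
  ≡⟨ allF-cong m (λ b → barsExactly-pointwise t c b w) ⟩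
    allF m (λ b → (not (does (c Fin.≟ b)) ∨ t c) ∧ (occurrences b w ≡ᵇ ind (clearAt c t b)))
  ≡⟨ allF-∧ m _ _ ⟩
    allF m (λ b → not (does (c Fin.≟ b)) ∨ t c) ∧ allF m (λ b → occurrences b w ≡ᵇ ind (clearAt c t b))
  ≡⟨ cong₂ _∧_ (allF-at m c (t c)) (sym (all-allF m _)) ⟩
    t c ∧ barsExactly (clearAt c t) w
  ∎
  where open ≡-Reasoning

barsExactly-[] : ∀ {m} (t : Fin m → Bool) → barsExactly t [] ≡ isZero (countTrue m t)
barsExactly-[] {m} t = trans (all-allF m _) (trans (allF-cong m (λ b → zeroWanted (t b))) (allF-not m t))
  where zeroWanted : ∀ b → (0 ≡ᵇ ind b) ≡ not b
        zeroWanted true  = refl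
        zeroWanted false = refl

guard↔ : ∀ {A : Set} (P : A → Bool) b X →
  Σ A (λ w → T (P w)) ↔ Fin X → Σ A (λ w → T (b ∧ P w)) ↔ Fin (if b then X else 0)
guard↔ P true  X e = e
guard↔ P false X e = empty↔ (λ { (_ , ()) })

BarWords-∷ : ∀ m l t → BarWords m (suc l) t
  ↔ (BarWords m l t ⊎ Σ (Fin m) (λ c → Σ (Vec (Maybe (Fin m)) l) (λ w → T (t c ∧ barsExactly (clearAt c t) w))))
BarWords-∷ m l t = mk↔ₛ′
  (λ { (nothing ∷ w , p) → inj₁ (w , p) ; (just c ∷ w , p) → inj₂ (c , (w , subst T (barsExactly-just t c w) p)) })
  (λ { (inj₁ (w , p)) → (nothing ∷ w) , p ; (inj₂ (c , (w , q))) → (just c ∷ w) , subst T (sym (barsExactly-just t c w)) q })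
  (λ { (inj₁ (w , p)) → refl ; (inj₂ (c , (w , q))) → cong (λ z → inj₂ (c , (w , z))) (BoolP.T-irrelevant _ _) })
  (λ { (nothing ∷ w , p) → refl ; (just c ∷ w , p) → cong (λ z → (just c ∷ w) , z) (BoolP.T-irrelevant _ _) })

-- With s wanted bars there are  l^{\underline{s}}  such words:
-- choose the positions of the bars in order.
BarWords↔ : ∀ m l t → BarWords m l t ↔ Fin (falling l (countTrue m t))
BarWords↔ m zero t =
  ↔-trans (mk↔ₛ′ (λ { ([] , p) → p }) (λ p → [] , p) (λ _ → refl) (λ { ([] , p) → refl }))
    (↔-trans (T-≡ (barsExactly-[] t)) (↔-trans (T↔ (isZero (countTrue m t))) (Fin-≡ (base (countTrue m t)))))
  where base : ∀ s → ind (isZero s) ≡ falling 0 s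
        base zero    = refl
        base (suc s) = refl
BarWords↔ m (suc l) t =
  ↔-trans (BarWords-∷ m l t)
    (↔-trans (BarWords↔ m l t ⊎-↔
               ↔-trans (Σ-↔ (λ c → guard↔ (barsExactly (clearAt c t)) (t c) _ (BarWords↔ m l (clearAt c t))))
                       (Σ-Fin↔ m (λ c → if t c then falling l (countTrue m (clearAt c t)) else 0)))
      (↔-trans (↔-sym FinP.+↔⊎) (Fin-≡ (trans (cong (falling l s ℕ.+_) count) (recurrence s)))))
  where
    s : ℕ
    s = countTrue m t
    count : sumFin m (λ c → if t c then falling l (countTrue m (clearAt c t)) else 0) ≡ s ℕ.* falling l (pred s)
    count = trans (sum-clearAt m t (λ b x → if b then falling l x else 0))
                  (trans (cong (s ℕ.* falling l (pred s) ℕ.+_) (ℕP.*-zeroʳ (countFalse m t))) (ℕP.+-identityʳ _))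
    recurrence : ∀ s → falling l s ℕ.+ s ℕ.* falling l (pred s) ≡ falling (suc l) s
    recurrence zero    = refl
    recurrence (suc s) = falling-suc l s

arrangements↔ : ∀ r m → Σ (Vec (Maybe (Fin m)) (r ℕ.+ m)) (λ w → T (isArrangement w)) ↔ Fin (rising (suc r) m)
arrangements↔ r m = ↔-trans (BarWords↔ m (r ℕ.+ m) (λ _ → true))
  (Fin-≡ (trans (cong (falling (r ℕ.+ m)) (countTrue-all m)) (falling-rising r m)))

Σ-ℕ↔ : ∀ B (c : ℕ → ℕ) → (∀ r → B ℕ.< r → c r ≡ 0) → Σ ℕ (λ r → Fin (c r)) ↔ Fin (sumℕ B c)
Σ-ℕ↔ zero    c vanish = ↔-trans Σ-ℕ-first (⊎-empty (λ { (r , i) → noElement (vanish (suc r) (s≤s z≤n)) i }))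
  where noElement : ∀ {a} → a ≡ 0 → Fin a → ⊥
        noElement refl ()
Σ-ℕ↔ (suc B) c vanish =
  ↔-trans Σ-ℕ-first (↔-trans (↔-refl ⊎-↔ Σ-ℕ↔ B (λ i → c (suc i)) (λ r B<r → vanish (suc r) (s≤s B<r)))
                             (↔-sym FinP.+↔⊎))

CallanData : ℕ → ℕ → ℕ → ℕ → Set
CallanData n k m r = (Σ (Vec (Fin (suc r)) n) (λ v → T (ordinaryBlocksNonempty v))
                    × Σ (Vec (Fin (suc r)) k) (λ v → T (ordinaryBlocksNonempty v)))
                    × Σ (Vec (Maybe (Fin m)) (r ℕ.+ m)) (λ w → T (isArrangement w))

Callan↔Σ : ∀ n k m → LabeledBarredCallan n k m ↔ Σ ℕ (CallanData n k m)
Callan↔Σ n k m = mk↔ₛ′ split join split-join join-split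
  where
    open Equivalence
    split : LabeledBarredCallan n k m → Σ ℕ (CallanData n k m)
    split (callan r red blue arr valid) = r , ((red , proj₁ redAndRest) , (blue , proj₁ blueAndArrangement)) , (arr , proj₂ blueAndArrangement)
      where
        redAndRest : T (ordinaryBlocksNonempty red) × T (ordinaryBlocksNonempty blue ∧ isArrangement arr)
        redAndRest = to BoolP.T-∧ valid
        blueAndArrangement : T (ordinaryBlocksNonempty blue) × T (isArrangement arr)
        blueAndArrangement = to BoolP.T-∧ (proj₂ redAndRest)
    join : Σ ℕ (CallanData n k m) → LabeledBarredCallan n k m
    join (r , ((red , p) , (blue , q)) , (arr , a)) = callan r red blue arr (from BoolP.T-∧ (p , from BoolP.T-∧ (q , a)))
    split-join : ∀ y → split (join y) ≡ y
    split-join (r , ((red , p) , (blue , q)) , (arr , a)) =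
      cong₂ (λ p′ qa → r , ((red , p′) , (blue , proj₁ qa)) , (arr , proj₂ qa))
            (BoolP.T-irrelevant _ _) (cong₂ _,_ (BoolP.T-irrelevant _ _) (BoolP.T-irrelevant _ _))
    join-split : ∀ x → join (split x) ≡ x
    join-split (callan r red blue arr valid) = cong (callan r red blue arr) (BoolP.T-irrelevant _ _)

CallanData↔ : ∀ n k m r → CallanData n k m r ↔ Fin (callanTerm n k m r)
CallanData↔ n k m r =
  ↔-trans ((blockAssignments↔ r n ×-↔ blockAssignments↔ r k) ×-↔ arrangements↔ r m)
          (↔-trans (↔-sym FinP.*↔× ×-↔ ↔-refl) (↔-sym FinP.*↔×))

callanTerm-vanish : ∀ n k m r → n ℕ.+ k ℕ.< r → callanTerm n k m r ≡ 0
callanTerm-vanish n k m r n+k<r =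
  cong (λ z → z ℕ.* markedWords 1 r k ℕ.* rising (suc r) m)
       (markedWords-vanish 1 r n (ℕP.≤-trans (s≤s (ℕP.m≤m+n n k)) n+k<r))

Callan↔callanCount : ∀ n k m → LabeledBarredCallan n k m ↔ Fin (callanCount n k m)
Callan↔callanCount n k m =
  ↔-trans (Callan↔Σ n k m)
    (↔-trans (Σ-↔ (CallanData↔ n k m))
             (Σ-ℕ↔ (n ℕ.+ k) (callanTerm n k m) (callanTerm-vanish n k m)))

mainTheorem2 : (n k m : ℕ) → .{{NonZero n}} → .{{NonZero k}} →
    Σ ℕ (λ N → (LabeledBarredCallan n k m ↔ Fin N) × (+ N ≡ symPolyBernoulli n k m))
    × (symPolyBernoulli n k m ≡ symPolyBernoulli k n m)
mainTheorem2 n k m =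
  (callanCount n k m , Callan↔callanCount n k m , callanCount≡symPolyBernoulli n k m) ,
  (begin
    symPolyBernoulli n k m   ≡⟨ sym (callanCount≡symPolyBernoulli n k m) ⟩
    + callanCount n k m      ≡⟨ cong +_ (callanCount-sym n k m) ⟩
    + callanCount k n m      ≡⟨ callanCount≡symPolyBernoulli k n m ⟩
    symPolyBernoulli k n m   ∎)
  where open ≡-Reasoning
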